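{- For every integer $n\ge 7$ and every graph $G$ on $n$ vertices, $$\min\{\gamma_c(G),\gamma_c(\overline{G})\}\le \left\lceil \sqrt{2n-4}\right\rceil-1;$$ equivalently, $n-\left\lceil\sqrt{2n-4}\right\rceil+1\le f(n)$.
   Context: All graphs are finite, simple and undirected; $\overline{G}$ denotes the complement of $G$. A set $S\subseteq V(G)$ is dominating if every vertex outside $S$ is adjacent to some vertex of $S$. The connected domination number $\gamma_c(G)$ is the minimum cardinality of a dominating set $S$ whose induced subgraph $G[S]$ is connected ($\infty$ if $G$ is disconnected). A minor of $G$ is a graph obtained from $G$ by a sequence of vertex deletions, edge deletions and edge contractions; $\Delta(H)$ is the maximum degree of $H$. For a positive integer $n$, $f(n)$ is the largest integer such that for every graph $G$ on $n$ vertices, $G$ or $\overline{G}$ has a minor $H$ with $\Delta(H)\ge f(n)$. -}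

module Defs where

open import Data.Nat using (ℕ; zero; suc; _*_; _≤ᵇ_)
open import Data.Bool using (Bool; true; false; if_then_else_; not)
open import Data.Fin using (Fin)
open import Data.Fin.Subset using (Subset; _∈_; _∉_)
open import Data.Product using (Σ; ∃; _×_)
open import Relation.Binary.PropositionalEquality using (_≡_; _≢_)

record Graph (n : ℕ) : Set where
  field
    adj   : Fin n → Fin n → Bool
    sym   : ∀ u v → adj u v ≡ adj v u
    irrefl : ∀ u → adj u u ≡ false

open Graph public

Adj : ∀ {n} → Graph n → Fin n → Fin n → Set
Adj G u v = adj G u v ≡ true

complement : ∀ {n} → Graph n → Graph n
complement G = record
  { adj    = λ u v → if isEq u v then false else not (adj G u v)
  ; sym    = symC
  ; irrefl = irrC
  }
  where
  open import Data.Fin using (_≟_)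
  open import Relation.Nullary.Decidable using (⌊_⌋)
  open import Relation.Binary.PropositionalEquality using (refl; cong)
  isEq : Fin _ → Fin _ → Bool
  isEq u v = ⌊ u ≟ v ⌋
  open import Data.Fin.Properties using (≡-isDecEquivalence)
  open import Relation.Nullary using (yes; no)
  symC : ∀ u v → (if isEq u v then false else not (adj G u v))
               ≡ (if isEq v u then false else not (adj G v u))
  symC u v with u ≟ v | v ≟ u
  ... | yes _ | yes _ = refl
  ... | yes refl | no ne = Data.Empty.⊥-elim (ne refl)
    where import Data.Empty
  ... | no ne | yes refl = Data.Empty.⊥-elim (ne refl)
    where import Data.Empty
  ... | no _ | no _ = cong not (Graph.sym G u v)
  irrC : ∀ u → (if isEq u u then false else not (adj G u u)) ≡ false
  irrC u with u ≟ u
  ... | yes _ = refl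
  ... | no ne = Data.Empty.⊥-elim (ne refl)
    where import Data.Empty

Dominating : ∀ {n} → Graph n → Subset n → Set
Dominating {n} G S = ∀ v → v ∉ S → Σ (Fin n) λ u → u ∈ S × Adj G v u

data WalkIn {n} (G : Graph n) (S : Subset n) : Fin n → Fin n → Set where
  here : ∀ {u} → WalkIn G S u u
  step : ∀ {u w v} → Adj G u w → w ∈ S → WalkIn G S w v → WalkIn G S u v

InducedConnected : ∀ {n} → Graph n → Subset n → Set
InducedConnected {n} G S =
  (Σ (Fin n) λ u → u ∈ S) × (∀ u v → u ∈ S → v ∈ S → WalkIn G S u v)

ConnectedDominating : ∀ {n} → Graph n → Subset n → Set
ConnectedDominating G S = Dominating G S × InducedConnected G S

-- ⌈√m⌉ : the least c with m ≤ c², found by bounded search (fuel m suffices).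
ceilSqrt : ℕ → ℕ
ceilSqrt m = search m 0
  where
  search : ℕ → ℕ → ℕ
  search zero c = c
  search (suc f) c = if m ≤ᵇ c * c then c else search f (suc c)

{-# OPTIONS --safe #-}

-- Fix a vertex v with neighbourhood A and non-neighbourhood B. Greedily, either at most k
-- vertices of A dominate B, so that together with v they form a connected dominating set
-- of G; or at most k vertices of B are such that every vertex of A misses one of them, so that
-- together with v they form a connected dominating set of the complement; or |B| > k².
-- Exchanging G and its complement, if neither graph has a connected dominating set of size
-- k + 1 then both |A| and |B| exceed k², so n ≥ 2k² + 3. With k = ⌈√(2n − 4)⌉ − 2 this is
-- impossible once n ≥ 7.

module Submission where

open import Defs
open import Data.Nat using (ℕ; _≤_; _∸_; _*_)
open import Data.Fin.Subset using (Subset; ∣_∣)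
open import Data.Product using (Σ; _×_)
open import Data.Sum using (_⊎_)

open import Data.Bool as Bool using (true; false; not; T)
open import Data.Bool.Properties using (not-involutive; ¬-not)
open import Data.Fin as Fin using (Fin; fromℕ<)
open import Data.Fin.Properties using (any?)
open import Data.Fin.Subset
  using (_∈_; _∉_; _⊆_; _⊈_; _∪_; _∩_; ∁; ⁅_⁆; ⊥; inside; outside)
open import Data.Fin.Subset.Properties
  using ( _∈?_; _⊆?_; ⊆-refl; ⊆-trans; ⊥⊆; s⊆s; ∣⊥∣≡0; ∣⁅x⁆∣≡1; ∣∁p∣≡n∸∣p∣
        ; x∈⁅x⁆; x∈⁅y⁆⇒x≡y; x≢y⇒x∉⁅y⁆; x∉p⇒x∈∁p; Empty-unique; p⊆q⇒∣p∣≤∣q∣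
        ; x∈p⇒∣p-x∣<∣p∣; p⊆p∪q; q⊆p∪q; x∈p∪q⁻; p∩q⊆p; x∈p∩q⁺; x∈p∩q⁻; x∈p⇒x∉∁p)
open import Data.Nat using (zero; suc; _+_; _<_; _≤ᵇ_; z≤n; s≤s; _≤?_; _<?_)
open import Data.Nat.Properties
open import Data.Nat.Tactic.RingSolver using (solve-∀)
open import Data.Product using (_,_; proj₂; ∃-syntax)
open import Data.Sum as Sum using (inj₁; inj₂; [_,_]′)
open import Data.Unit using (tt)
open import Data.Vec using (_∷_; []; tabulate)
open import Data.Vec.Properties using ([]=⇒lookup; lookup⇒[]=; lookup∘tabulate)
open import Function using (_∘_)
open import Relation.Binary.PropositionalEquality as ≡
  using (_≡_; _≢_; refl; trans; cong; subst)
open import Relation.Nullary using (yes; no; ¬_; contradiction)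
open import Relation.Nullary.Decidable using (_×-dec_; ¬?; decidable-stable)

private
  variable
    n k : ℕ
    p q r X Y : Subset n
    u v w : Fin n
    H H' : Graph n

-- The search function local to ceilSqrt cannot be named from outside Defs; the meta `search`
-- is solved by unification with the normal form of ceilSqrt (suc f), whose arguments the
-- with-abstraction has turned into variables.
mutual
  private
    search : ℕ → ℕ → ℕ → ℕ
    search = _

    recover-search : ∀ f → ceilSqrt (suc f) ≡ ceilSqrt (suc f)
    recover-search f with suc f | 1
    ... | m | c = refl {x = search m f c}

search-sound : ∀ m f c → m ≤ (f + c) * (f + c) → m ≤ search m f c * search m f c
search-sound m zero    c m≤c² = m≤c²
search-sound m (suc f) c m≤[1+f+c]² with m ≤ᵇ c * c in m≤ᵇc²
... | true  = ≤ᵇ⇒≤ m (c * c) (subst T (≡.sym m≤ᵇc²) tt)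
... | false = search-sound m f (suc c) (subst (λ x → m ≤ x * x) (≡.sym (+-suc f c)) m≤[1+f+c]²)

≤-ceilSqrt² : ∀ m → m ≤ ceilSqrt m * ceilSqrt m
≤-ceilSqrt² zero    = z≤n
≤-ceilSqrt² (suc f) =
  search-sound (suc f) f 1 (subst (λ x → suc f ≤ x * x) (+-comm 1 f) (m≤m*n (suc f) (suc f)))

+-sucʳ-cong : ∀ {a b c d} → a + b ≡ c + d → a + suc b ≡ c + suc d
+-sucʳ-cong {a} {b} {c} {d} eq = trans (+-suc a b) (trans (cong suc eq) (≡.sym (+-suc c d)))

∣p∩q∣+∣p∪q∣≡∣p∣+∣q∣ : ∀ (p q : Subset n) → ∣ p ∩ q ∣ + ∣ p ∪ q ∣ ≡ ∣ p ∣ + ∣ q ∣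
∣p∩q∣+∣p∪q∣≡∣p∣+∣q∣ []            []            = refl
∣p∩q∣+∣p∪q∣≡∣p∣+∣q∣ (outside ∷ p) (outside ∷ q) = ∣p∩q∣+∣p∪q∣≡∣p∣+∣q∣ p q
∣p∩q∣+∣p∪q∣≡∣p∣+∣q∣ (inside  ∷ p) (outside ∷ q) =
  trans (+-suc ∣ p ∩ q ∣ ∣ p ∪ q ∣) (cong suc (∣p∩q∣+∣p∪q∣≡∣p∣+∣q∣ p q))
∣p∩q∣+∣p∪q∣≡∣p∣+∣q∣ (outside ∷ p) (inside  ∷ q) = +-sucʳ-cong (∣p∩q∣+∣p∪q∣≡∣p∣+∣q∣ p q)
∣p∩q∣+∣p∪q∣≡∣p∣+∣q∣ (inside  ∷ p) (inside  ∷ q) = cong suc (+-sucʳ-cong (∣p∩q∣+∣p∪q∣≡∣p∣+∣q∣ p q))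

∣p∪q∣≤∣p∣+∣q∣ : ∀ (p q : Subset n) → ∣ p ∪ q ∣ ≤ ∣ p ∣ + ∣ q ∣
∣p∪q∣≤∣p∣+∣q∣ p q = subst (∣ p ∪ q ∣ ≤_) (∣p∩q∣+∣p∪q∣≡∣p∣+∣q∣ p q) (m≤n+m ∣ p ∪ q ∣ ∣ p ∩ q ∣)

p⊆r∧q⊆r⇒p∪q⊆r : p ⊆ r → q ⊆ r → p ∪ q ⊆ r
p⊆r∧q⊆r⇒p∪q⊆r {p = p} {q = q} p⊆r q⊆r x∈p∪q = [ p⊆r , q⊆r ]′ (x∈p∪q⁻ p q x∈p∪q)

x∈p⇒⁅x⁆⊆p : u ∈ p → ⁅ u ⁆ ⊆ p
x∈p⇒⁅x⁆⊆p {u = u} {p = p} u∈p x∈⁅u⁆ = subst (_∈ p) (≡.sym (x∈⁅y⁆⇒x≡y u x∈⁅u⁆)) u∈p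

disjoint⇒∣p∣+∣q∣≤∣r∣ : ∀ {n} {p q r : Subset n} →
                       p ⊆ r → q ⊆ r → (∀ {x} → x ∈ p → x ∉ q) → ∣ p ∣ + ∣ q ∣ ≤ ∣ r ∣
disjoint⇒∣p∣+∣q∣≤∣r∣ {n} {p} {q} {r} p⊆r q⊆r disjoint = begin
  ∣ p ∣ + ∣ q ∣          ≡⟨ ∣p∩q∣+∣p∪q∣≡∣p∣+∣q∣ p q ⟨
  ∣ p ∩ q ∣ + ∣ p ∪ q ∣  ≡⟨ cong (_+ ∣ p ∪ q ∣) ∣p∩q∣≡0 ⟩
  ∣ p ∪ q ∣              ≤⟨ p⊆q⇒∣p∣≤∣q∣ (p⊆r∧q⊆r⇒p∪q⊆r p⊆r q⊆r) ⟩
  ∣ r ∣                  ∎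
  where
  open ≤-Reasoning
  p∩q-empty : ¬ (∃[ x ] x ∈ p ∩ q)
  p∩q-empty (x , x∈p∩q) = let x∈p , x∈q = x∈p∩q⁻ p q x∈p∩q in disjoint x∈p x∈q
  ∣p∩q∣≡0 : ∣ p ∩ q ∣ ≡ 0
  ∣p∩q∣≡0 = trans (cong ∣_∣ (Empty-unique p∩q-empty)) (∣⊥∣≡0 n)

∣∁⁅x⁆∣<n : (x : Fin n) → ∣ ∁ ⁅ x ⁆ ∣ < n
∣∁⁅x⁆∣<n {suc n} x =
  subst (_< suc n) (≡.sym (trans (∣∁p∣≡n∸∣p∣ ⁅ x ⁆) (cong (suc n ∸_) (∣⁅x⁆∣≡1 x)))) ≤-refl

⊆-ofSize : ∀ m (p : Subset n) → m ≤ ∣ p ∣ → ∃[ q ] q ⊆ p × ∣ q ∣ ≡ m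
⊆-ofSize {n} zero p             _           = ⊥ , ⊥⊆ , ∣⊥∣≡0 n
⊆-ofSize     (suc m) []            ()
⊆-ofSize     (suc m) (outside ∷ p) m<∣p∣       =
  let q , q⊆p , ∣q∣≡m = ⊆-ofSize (suc m) p m<∣p∣ in outside ∷ q , s⊆s q⊆p , ∣q∣≡m
⊆-ofSize     (suc m) (inside ∷ p)  (s≤s m≤∣p∣) =
  let q , q⊆p , ∣q∣≡m = ⊆-ofSize m p m≤∣p∣ in inside ∷ q , s⊆s q⊆p , cong suc ∣q∣≡m

⊈⇒∃∉ : p ⊈ q → ∃[ x ] x ∈ p × x ∉ q
⊈⇒∃∉ {p = p} {q = q} p⊈q with any? (λ x → x ∈? p ×-dec ¬? (x ∈? q))
... | yes witness = witness
... | no  none    =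
  contradiction (λ {x} x∈p → decidable-stable (x ∈? q) (λ x∉q → none (x , x∈p , x∉q))) p⊈q

module _ (N : Fin n → Subset n) where

  Covers : Subset n → Subset n → Set
  Covers Y B = ∀ {b} → b ∈ B → ∃[ y ] y ∈ Y × b ∈ N y

  module _ (A : Subset n) where

    SmallCover : ℕ → Subset n → Set
    SmallCover s B = ∃[ Y ] Y ⊆ A × ∣ Y ∣ ≤ s × Covers Y B

    -- No vertex of A sees all of X: in a graph, X dominates A in the complement.
    SmallBlocker : ℕ → Subset n → Set
    SmallBlocker m B = ∃[ X ] X ⊆ B × ∣ X ∣ ≤ m × (∀ {a} → a ∈ A → X ⊈ N a)

    seer⊎blocked : ∀ X → (∃[ a ] a ∈ A × X ⊆ N a) ⊎ (∀ {a} → a ∈ A → X ⊈ N a)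
    seer⊎blocked X with any? (λ a → a ∈? A ×-dec X ⊆? N a)
    ... | yes seer  = inj₁ seer
    ... | no  ¬seer = inj₂ λ a∈A X⊆Na → ¬seer (_ , a∈A , X⊆Na)

    extend-cover : ∀ {s a B} → a ∈ A → SmallCover s (B ∩ ∁ (N a)) → SmallCover (suc s) B
    extend-cover {s} {a} {B} a∈A (Y , Y⊆A , ∣Y∣≤s , covers) =
      Y ∪ ⁅ a ⁆ , p⊆r∧q⊆r⇒p∪q⊆r Y⊆A (x∈p⇒⁅x⁆⊆p a∈A) , size , covers′
      where
      size : ∣ Y ∪ ⁅ a ⁆ ∣ ≤ suc s
      size = begin
        ∣ Y ∪ ⁅ a ⁆ ∣      ≤⟨ ∣p∪q∣≤∣p∣+∣q∣ Y ⁅ a ⁆ ⟩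
        ∣ Y ∣ + ∣ ⁅ a ⁆ ∣  ≡⟨ cong (∣ Y ∣ +_) (∣⁅x⁆∣≡1 a) ⟩
        ∣ Y ∣ + 1          ≤⟨ +-monoˡ-≤ 1 ∣Y∣≤s ⟩
        s + 1              ≡⟨ +-comm s 1 ⟩
        suc s              ∎
        where open ≤-Reasoning
      covers′ : Covers (Y ∪ ⁅ a ⁆) B
      covers′ {b} b∈B with b ∈? N a
      ... | yes b∈Na = a , q⊆p∪q Y ⁅ a ⁆ (x∈⁅x⁆ a) , b∈Na
      ... | no  b∉Na =
        let y , y∈Y , b∈Ny = covers (x∈p∩q⁺ (b∈B , x∉p⇒x∈∁p b∉Na))
        in  y , p⊆p∪q ⁅ a ⁆ y∈Y , b∈Ny

    restrict-blocker : ∀ {m B B′} → B′ ⊆ B → SmallBlocker m B′ → SmallBlocker m B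
    restrict-blocker B′⊆B (X , X⊆B′ , ∣X∣≤m , blocked) = X , ⊆-trans X⊆B′ B′⊆B , ∣X∣≤m , blocked

    -- Choose m vertices X of B. Either X is a blocker, or some a ∈ A sees all of X; then a joins
    -- the cover, and the part of B that a does not see is disjoint from X, so it is m smaller.
    cover⊎blocker⊎large : ∀ m s B → SmallCover s B ⊎ SmallBlocker m B ⊎ s * m < ∣ B ∣
    cover⊎blocker⊎large m zero B with 0 <? ∣ B ∣
    ... | yes B≢∅ = inj₂ (inj₂ B≢∅)
    ... | no  B≡∅ = inj₁ (⊥ , ⊥⊆ , ≤-reflexive (∣⊥∣≡0 n) ,
                          λ b∈B → contradiction (≤-<-trans z≤n (x∈p⇒∣p-x∣<∣p∣ b∈B)) B≡∅)
    cover⊎blocker⊎large m (suc s) B with ∣ B ∣ ≤? m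
    ... | yes ∣B∣≤m with seer⊎blocked B
    ...   | inj₁ (a , a∈A , B⊆Na) =
      inj₁ (⁅ a ⁆ , x∈p⇒⁅x⁆⊆p a∈A , ≤-trans (≤-reflexive (∣⁅x⁆∣≡1 a)) (s≤s z≤n) ,
            λ b∈B → a , x∈⁅x⁆ a , B⊆Na b∈B)
    ...   | inj₂ blocked = inj₂ (inj₁ (B , ⊆-refl , ∣B∣≤m , blocked))
    cover⊎blocker⊎large m (suc s) B | no ∣B∣≰m
      with X , X⊆B , ∣X∣≡m ← ⊆-ofSize m B (<⇒≤ (≰⇒> ∣B∣≰m))
      with seer⊎blocked X
    ... | inj₂ blocked = inj₂ (inj₁ (X , X⊆B , ≤-reflexive ∣X∣≡m , blocked))
    ... | inj₁ (a , a∈A , X⊆Na) with cover⊎blocker⊎large m s (B ∩ ∁ (N a))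
    ...   | inj₁ cover        = inj₁ (extend-cover a∈A cover)
    ...   | inj₂ (inj₁ block) = inj₂ (inj₁ (restrict-blocker (p∩q⊆p B (∁ (N a))) block))
    ...   | inj₂ (inj₂ large) = inj₂ (inj₂ (begin-strict
      m + s * m               <⟨ +-monoʳ-< m large ⟩
      m + ∣ B ∩ ∁ (N a) ∣     ≡⟨ cong (_+ ∣ B ∩ ∁ (N a) ∣) ∣X∣≡m ⟨
      ∣ X ∣ + ∣ B ∩ ∁ (N a) ∣ ≤⟨ disjoint⇒∣p∣+∣q∣≤∣r∣ X⊆B (p∩q⊆p B (∁ (N a))) X∩B′≡∅ ⟩
      ∣ B ∣                   ∎))
      where
      open ≤-Reasoning
      X∩B′≡∅ : ∀ {x} → x ∈ X → x ∉ B ∩ ∁ (N a)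
      X∩B′≡∅ x∈X x∈B′ = x∈p⇒x∉∁p (X⊆Na x∈X) (proj₂ (x∈p∩q⁻ B (∁ (N a)) x∈B′))

neighbours : Graph n → Fin n → Subset n
neighbours H v = tabulate (adj H v)

∈-neighbours⁺ : ∀ H → Adj H v w → w ∈ neighbours H v
∈-neighbours⁺ {v = v} {w = w} H vw =
  lookup⇒[]= w (neighbours H v) (trans (lookup∘tabulate (adj H v) w) vw)

∈-neighbours⁻ : ∀ H → w ∈ neighbours H v → Adj H v w
∈-neighbours⁻ {w = w} {v = v} H w∈Nv =
  trans (≡.sym (lookup∘tabulate (adj H v) w)) ([]=⇒lookup w∈Nv)

Adj-sym : ∀ H → Adj H u w → Adj H w u
Adj-sym {u = u} {w = w} H uw = trans (Graph.sym H w u) uw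

Adj⇒≢ : ∀ H → Adj H u w → u ≢ w
Adj⇒≢ {u = u} H uu refl = contradiction (trans (≡.sym uu) (irrefl H u)) λ ()

neighbours⊆∁⁅v⁆ : ∀ H → neighbours H v ⊆ ∁ ⁅ v ⁆
neighbours⊆∁⁅v⁆ H w∈Nv = x∉p⇒x∈∁p (x≢y⇒x∉⁅y⁆ (Adj⇒≢ H (∈-neighbours⁻ H w∈Nv) ∘ ≡.sym))

_++ʷ_ : ∀ {S : Subset n} → WalkIn H S u v → WalkIn H S v w → WalkIn H S u w
here            ++ʷ q = q
step uv v∈S p   ++ʷ q = step uv v∈S (p ++ʷ q)

star-connected : ∀ {S} → v ∈ S → (∀ {u} → u ∈ S → u ≡ v ⊎ Adj H v u) → InducedConnected H S
star-connected {v = v} {H = H} {S = S} v∈S spoke =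
  (v , v∈S) , λ u w u∈S w∈S → toCentre u∈S ++ʷ fromCentre w∈S
  where
  toCentre : u ∈ S → WalkIn H S u v
  toCentre u∈S with spoke u∈S
  ... | inj₁ refl = here
  ... | inj₂ vu   = step (Adj-sym H vu) v∈S here
  fromCentre : u ∈ S → WalkIn H S v u
  fromCentre u∈S with spoke u∈S
  ... | inj₁ refl = here
  ... | inj₂ vu   = step vu u∈S here

γc[_]≤_ : Graph n → ℕ → Set
γc[ G ]≤ K = Σ (Subset _) λ S → ConnectedDominating G S × ∣ S ∣ ≤ K

-- A record, so that H and H' can be inferred from a proof of it.
record Complementary (H H' : Graph n) : Set where
  field
    adj≡not-adj : u ≢ w → adj H' u w ≡ not (adj H u w)

open Complementary

complement-complementary : (G : Graph n) → Complementary G (complement G)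
complement-complementary G .adj≡not-adj {u} {w} u≢w with u Fin.≟ w
... | yes u≡w = contradiction u≡w u≢w
... | no  _   = refl

Complementary-sym : Complementary H H' → Complementary H' H
Complementary-sym {H = H} H∁H' .adj≡not-adj {u} {w} u≢w =
  trans (≡.sym (not-involutive (adj H u w))) (cong not (≡.sym (H∁H' .adj≡not-adj u≢w)))

module _ {H H' : Graph n} (H∁H' : Complementary H H') where

  Adj-complementary : u ≢ w → ¬ Adj H u w → Adj H' u w
  Adj-complementary u≢w ¬uw = trans (H∁H' .adj≡not-adj u≢w) (cong not (¬-not ¬uw))

  ¬Adj-complementary : Adj H' u w → ¬ Adj H u w
  ¬Adj-complementary u'w uw =
    contradiction (trans (≡.sym u'w) (trans (H∁H' .adj≡not-adj (Adj⇒≢ H' u'w)) (cong not uw)))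
                  λ ()

  ∣neighbours∣+∣neighbours∣<n : ∀ v → ∣ neighbours H v ∣ + ∣ neighbours H' v ∣ < n
  ∣neighbours∣+∣neighbours∣<n v = ≤-<-trans
    (disjoint⇒∣p∣+∣q∣≤∣r∣ (neighbours⊆∁⁅v⁆ H) (neighbours⊆∁⁅v⁆ H')
      λ w∈Nv w∈N'v → ¬Adj-complementary (∈-neighbours⁻ H' w∈N'v) (∈-neighbours⁻ H w∈Nv))
    (∣∁⁅x⁆∣<n v)

  star-γc : Y ⊆ neighbours H v → ∣ Y ∣ ≤ k → Covers (neighbours H) Y (neighbours H' v) →
            γc[ H ]≤ suc k
  star-γc {Y = Y} {v = v} {k = k} Y⊆Nv ∣Y∣≤k covers =
    ⁅ v ⁆ ∪ Y , (dominating , star-connected v∈S spoke) , size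
    where
    v∈S : v ∈ ⁅ v ⁆ ∪ Y
    v∈S = p⊆p∪q Y (x∈⁅x⁆ v)
    spoke : ∀ {u} → u ∈ ⁅ v ⁆ ∪ Y → u ≡ v ⊎ Adj H v u
    spoke u∈S = Sum.map (x∈⁅y⁆⇒x≡y v) (∈-neighbours⁻ H ∘ Y⊆Nv) (x∈p∪q⁻ ⁅ v ⁆ Y u∈S)
    dominating : Dominating H (⁅ v ⁆ ∪ Y)
    dominating w w∉S with adj H v w Bool.≟ true
    ... | yes vw  = v , v∈S , Adj-sym H vw
    ... | no  ¬vw =
      let v≢w = λ v≡w → w∉S (subst (_∈ ⁅ v ⁆ ∪ Y) v≡w v∈S)
          y , y∈Y , w∈Ny = covers (∈-neighbours⁺ H' (Adj-complementary v≢w ¬vw))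
      in y , q⊆p∪q ⁅ v ⁆ Y y∈Y , Adj-sym H (∈-neighbours⁻ H w∈Ny)
    size : ∣ ⁅ v ⁆ ∪ Y ∣ ≤ suc k
    size = ≤-trans (∣p∪q∣≤∣p∣+∣q∣ ⁅ v ⁆ Y)
                   (subst (λ c → c + ∣ Y ∣ ≤ suc k) (≡.sym (∣⁅x⁆∣≡1 v)) (s≤s ∣Y∣≤k))

  blocker⇒covers : X ⊆ neighbours H' v → (∀ {a} → a ∈ neighbours H v → X ⊈ neighbours H a) →
                   Covers (neighbours H') X (neighbours H v)
  blocker⇒covers {X = X} {v = v} X⊆N'v blocked {w} w∈Nv =
    let x , x∈X , x∉Nw = ⊈⇒∃∉ (blocked w∈Nv)
        x≢w = λ x≡w → ¬Adj-complementary (∈-neighbours⁻ H' (X⊆N'v x∈X))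
                        (subst (Adj H v) (≡.sym x≡w) (∈-neighbours⁻ H w∈Nv))
    in x , x∈X , ∈-neighbours⁺ H' (Adj-complementary x≢w (x∉Nw ∘ ∈-neighbours⁺ H ∘ Adj-sym H))

γc⊎γc⊎large : Complementary H H' → ∀ v k →
              γc[ H ]≤ suc k ⊎ γc[ H' ]≤ suc k ⊎ k * k < ∣ neighbours H' v ∣
γc⊎γc⊎large {H = H} {H' = H'} H∁H' v k
  with cover⊎blocker⊎large (neighbours H) (neighbours H v) k k (neighbours H' v)
... | inj₁ (Y , Y⊆Nv , ∣Y∣≤k , covers) = inj₁ (star-γc H∁H' Y⊆Nv ∣Y∣≤k covers)
... | inj₂ (inj₁ (X , X⊆N'v , ∣X∣≤k , blocked)) =
  inj₂ (inj₁ (star-γc (Complementary-sym H∁H') X⊆N'v ∣X∣≤k (blocker⇒covers H∁H' X⊆N'v blocked)))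
... | inj₂ (inj₂ large) = inj₂ (inj₂ large)

γc⊎γc-complement : ∀ k → n ≤ 2 * (k * k + 1) → Fin n → (G : Graph n) →
                   γc[ G ]≤ suc k ⊎ γc[ complement G ]≤ suc k
γc⊎γc-complement {n} k n≤2[k²+1] v G
  with γc⊎γc⊎large (complement-complementary G) v k
     | γc⊎γc⊎large (Complementary-sym (complement-complementary G)) v k
... | inj₁ small         | _                   = inj₁ small
... | inj₂ (inj₁ small)  | _                   = inj₂ small
... | inj₂ (inj₂ _)      | inj₁ small          = inj₂ small
... | inj₂ (inj₂ _)      | inj₂ (inj₁ small)   = inj₁ small
... | inj₂ (inj₂ k²<∣N̄v∣) | inj₂ (inj₂ k²<∣Nv∣) = contradiction n≤2[k²+1] (<⇒≱ (begin-strict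
  2 * (k * k + 1)                                    ≡⟨ cong (2 *_) (+-comm (k * k) 1) ⟩
  suc (k * k) + (suc (k * k) + 0)                    ≡⟨ cong (suc (k * k) +_) (+-identityʳ _) ⟩
  suc (k * k) + suc (k * k)                          ≤⟨ +-mono-≤ k²<∣Nv∣ k²<∣N̄v∣ ⟩
  ∣ neighbours G v ∣ + ∣ neighbours (complement G) v ∣ <⟨ ∣N∣+∣N̄∣<n ⟩
  n                                                  ∎))
  where
  open ≤-Reasoning
  ∣N∣+∣N̄∣<n = ∣neighbours∣+∣neighbours∣<n (complement-complementary G) v

private
  square-bound-identity : ∀ j → 4 + (4 + j) * (4 + j) + (3 * (j * j) + 8 * j)
                              ≡ 2 * (2 * ((2 + j) * (2 + j) + 1))
  square-bound-identity = solve-∀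

10≤r²⇒4≤r : ∀ r → 10 ≤ r * r → 4 ≤ r
10≤r²⇒4≤r r 10≤r² = ≮⇒≥ λ r<4 → <⇒≱ (s≤s (*-mono-≤ (≤-pred r<4) (≤-pred r<4))) 10≤r²

square-bound : ∀ {n} r → 7 ≤ n → 2 * n ∸ 4 ≤ r * r → ∃[ k ] r ∸ 1 ≡ suc k × n ≤ 2 * (k * k + 1)
square-bound {n} r 7≤n 2n∸4≤r²
  with j , refl ← m≤n⇒∃[o]m+o≡n (10≤r²⇒4≤r r (≤-trans (∸-monoˡ-≤ 4 (*-monoʳ-≤ 2 7≤n)) 2n∸4≤r²)) =
  2 + j , refl , *-cancelˡ-≤ 2 (begin
    2 * n                                         ≤⟨ m≤n+m∸n (2 * n) 4 ⟩
    4 + (2 * n ∸ 4)                               ≤⟨ +-monoʳ-≤ 4 2n∸4≤r² ⟩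
    4 + (4 + j) * (4 + j)                         ≤⟨ m≤m+n _ _ ⟩
    4 + (4 + j) * (4 + j) + (3 * (j * j) + 8 * j) ≡⟨ square-bound-identity j ⟩
    2 * (2 * ((2 + j) * (2 + j) + 1))             ∎)
  where open ≤-Reasoning

corollary27 : (n : ℕ) → 7 ≤ n → (G : Graph n) →
    (Σ (Subset n) λ S → ConnectedDominating G S × ∣ S ∣ ≤ ceilSqrt (2 * n ∸ 4) ∸ 1)
    ⊎ (Σ (Subset n) λ S → ConnectedDominating (complement G) S × ∣ S ∣ ≤ ceilSqrt (2 * n ∸ 4) ∸ 1)
corollary27 n 7≤n G
  with k , K≡1+k , n≤2[k²+1] ← square-bound (ceilSqrt (2 * n ∸ 4)) 7≤n (≤-ceilSqrt² (2 * n ∸ 4))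
  rewrite K≡1+k = γc⊎γc-complement k n≤2[k²+1] (fromℕ< 7≤n) G
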